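{- For $s\geq 1$ let $F_*(s)$ denote the number of self-conjugate partitions with distinct parts that are simultaneously $s$-cores and $(s+1)$-cores. Then $F_*(1)=1$, $F_*(2)=2$, and $F_*(2\alpha)=F_*(2\alpha+1)=\alpha+1$ for every integer $\alpha\geq 1$.
   Context: A partition is self-conjugate if its Young diagram is symmetric about the main diagonal. An $a$-core is a partition with no hook length equal to $a$. The empty partition is counted. -}

module Defs where

open import Data.Nat using (ℕ; zero; suc; _+_; _∸_; _<_; _≤_; _>_; _≥_; _≤?_)
open import Data.List using (List; []; _∷_; length; filter; map; upTo)
open import Data.List.Relation.Unary.All using (All)
open import Data.List.Relation.Unary.Linked using (Linked)
open import Data.List.Relation.Unary.Unique.Propositional using (Unique)
open import Data.List.Membership.Propositional using (_∈_)
open import Data.Product using (Σ; _×_)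
open import Function.Bundles using (_⇔_)
open import Relation.Binary.PropositionalEquality using (_≡_; _≢_)

IsPartition : List ℕ → Set
IsPartition λ′ = All (0 <_) λ′ × Linked _≥_ λ′

HasDistinctParts : List ℕ → Set
HasDistinctParts λ′ = Linked _>_ λ′

-- i-th part (0-indexed), 0 beyond the length.
part : List ℕ → ℕ → ℕ
part []       _       = 0
part (x ∷ _)  zero    = x
part (_ ∷ xs) (suc i) = part xs i

-- j-th part (0-indexed) of the conjugate: number of parts > j.
conjPart : List ℕ → ℕ → ℕ
conjPart λ′ j = length (filter (λ x → suc j ≤? x) λ′)

conjugate : List ℕ → List ℕ
conjugate λ′ = map (conjPart λ′) (upTo (part λ′ 0))

SelfConjugate : List ℕ → Set
SelfConjugate λ′ = conjugate λ′ ≡ λ′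

-- hook length of the cell in row i, column j (0-indexed), for j < part λ i:
-- arm + leg + 1
hook : List ℕ → ℕ → ℕ → ℕ
hook λ′ i j = (part λ′ i ∸ suc j) + (conjPart λ′ j ∸ suc i) + 1

IsCore : ℕ → List ℕ → Set
IsCore a λ′ = ∀ i j → j < part λ′ i → hook λ′ i j ≢ a

HasCount : (List ℕ → Set) → ℕ → Set
HasCount P n = Σ (List (List ℕ)) λ L →
  Unique L × (∀ μ → (μ ∈ L) ⇔ P μ) × length L ≡ n

Fstar-set : ℕ → List ℕ → Set
Fstar-set s μ = IsPartition μ × HasDistinctParts μ × SelfConjugate μ
              × IsCore s μ × IsCore (suc s) μ

-- A self-conjugate partition μ has as many parts as its largest part; if its
-- parts are moreover distinct and positive, this forces μ to be the staircase
-- (k, k-1, ..., 1). The hooks of the staircase of size k all lie below 2k, and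
-- its first row realises every odd hook 1, 3, ..., 2k-1. Of s and s+1 exactly
-- one is odd, say 2m+1, and the other is at least 2m, so the staircase is a
-- simultaneous s- and (s+1)-core iff k ≤ m.
module Submission where

open import Defs
open import Data.Empty using (⊥-elim)
open import Data.List using (List; []; _∷_; length; filter; map; applyUpTo; upTo)
open import Data.List.Properties using (filter-accept; filter-reject; length-map; length-upTo; length-applyUpTo; map-upTo)
open import Data.List.Membership.Propositional using (_∈_)
open import Data.List.Membership.Propositional.Properties using (∈-applyUpTo⁺; ∈-applyUpTo⁻)
open import Data.List.Relation.Unary.All using (All; []; _∷_)
open import Data.List.Relation.Unary.Linked using (Linked; []; [-]; _∷_)
import Data.List.Relation.Unary.Linked as Linked
open import Data.List.Relation.Unary.Unique.Propositional.Properties using (applyUpTo⁺₁)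
open import Data.Nat using (ℕ; zero; suc; _+_; _*_; _∸_; _≤_; _<_; _>_; _≥_; z≤n; s≤s; _≤?_)
open import Data.Nat.Properties
open import Data.Product using (_×_; _,_; ∃-syntax)
open import Function.Base using (_∘_)
open import Function.Bundles using (_⇔_; mk⇔)
open import Relation.Binary.PropositionalEquality
open import Relation.Nullary using (¬_; yes; no)

staircase : ℕ → List ℕ
staircase zero    = []
staircase (suc k) = suc k ∷ staircase k

length-staircase : ∀ k → length (staircase k) ≡ k
length-staircase zero    = refl
length-staircase (suc k) = cong suc (length-staircase k)

part-staircase-0 : ∀ k → part (staircase k) 0 ≡ k
part-staircase-0 zero    = refl
part-staircase-0 (suc k) = refl

part-staircase-≤ : ∀ k i → part (staircase k) i ≤ k
part-staircase-≤ zero    i       = z≤n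
part-staircase-≤ (suc k) zero    = ≤-refl
part-staircase-≤ (suc k) (suc i) = m≤n⇒m≤1+n (part-staircase-≤ k i)

conjPart-staircase : ∀ k j → conjPart (staircase k) j ≡ k ∸ j
conjPart-staircase zero    j = sym (0∸n≡0 j)
conjPart-staircase (suc k) j with suc j ≤? suc k
... | yes j<1+k = begin
  length (filter (suc j ≤?_) (suc k ∷ staircase k))  ≡⟨ cong length (filter-accept (suc j ≤?_) j<1+k) ⟩
  suc (conjPart (staircase k) j)                      ≡⟨ cong suc (conjPart-staircase k j) ⟩
  suc (k ∸ j)                                         ≡⟨ +-∸-assoc 1 (≤-pred j<1+k) ⟨
  suc k ∸ j                                           ∎
  where open ≡-Reasoning
... | no j≮1+k = begin
  length (filter (suc j ≤?_) (suc k ∷ staircase k))  ≡⟨ cong length (filter-reject (suc j ≤?_) j≮1+k) ⟩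
  conjPart (staircase k) j                            ≡⟨ conjPart-staircase k j ⟩
  k ∸ j                                               ≡⟨ m≤n⇒m∸n≡0 (<⇒≤ k<j) ⟩
  0                                                   ≡⟨ m≤n⇒m∸n≡0 k<j ⟨
  suc k ∸ j                                           ∎
  where open ≡-Reasoning
        k<j : k < j
        k<j = ≤-pred (≰⇒> j≮1+k)

staircase-hasDistinctParts : ∀ k → HasDistinctParts (staircase k)
staircase-hasDistinctParts zero          = []
staircase-hasDistinctParts (suc zero)    = [-]
staircase-hasDistinctParts (suc (suc k)) = ≤-refl ∷ staircase-hasDistinctParts (suc k)

staircase-isPartition : ∀ k → IsPartition (staircase k)
staircase-isPartition k = positive k , Linked.map <⇒≤ (staircase-hasDistinctParts k)
  where
    positive : ∀ k → All (0 <_) (staircase k)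
    positive zero    = []
    positive (suc k) = s≤s z≤n ∷ positive k

applyUpTo-∸≡staircase : ∀ n (f : ℕ → ℕ) → (∀ j → f j ≡ n ∸ j) → applyUpTo f n ≡ staircase n
applyUpTo-∸≡staircase zero    f f≗n∸ = refl
applyUpTo-∸≡staircase (suc n) f f≗n∸ =
  cong₂ _∷_ (f≗n∸ 0) (applyUpTo-∸≡staircase n (λ j → f (suc j)) (λ j → f≗n∸ (suc j)))

staircase-selfConjugate : ∀ k → SelfConjugate (staircase k)
staircase-selfConjugate k = begin
  conjugate (staircase k)                ≡⟨ cong (map (conjPart (staircase k)) ∘ upTo) (part-staircase-0 k) ⟩
  map (conjPart (staircase k)) (upTo k)  ≡⟨ map-upTo (conjPart (staircase k)) k ⟩
  applyUpTo (conjPart (staircase k)) k   ≡⟨ applyUpTo-∸≡staircase k _ (conjPart-staircase k) ⟩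
  staircase k                            ∎
  where open ≡-Reasoning

hook-staircase-< : ∀ k i j → j < part (staircase k) i → hook (staircase k) i j < k + k
hook-staircase-< (suc k) i j _ = begin-strict
  (part (staircase (suc k)) i ∸ suc j) + (conjPart (staircase (suc k)) j ∸ suc i) + 1
    ≤⟨ +-monoˡ-≤ 1 (+-mono-≤ arm≤k leg≤k) ⟩
  k + k + 1       ≡⟨ +-comm (k + k) 1 ⟩
  suc (k + k)     <⟨ s≤s (≤-reflexive (sym (+-suc k k))) ⟩
  suc k + suc k   ∎
  where
    open ≤-Reasoning
    arm≤k : part (staircase (suc k)) i ∸ suc j ≤ k
    arm≤k = ∸-mono (part-staircase-≤ (suc k) i) (s≤s z≤n)
    leg≤k : conjPart (staircase (suc k)) j ∸ suc i ≤ k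
    leg≤k = ∸-mono (≤-trans (≤-reflexive (conjPart-staircase (suc k) j)) (m∸n≤m (suc k) j)) (s≤s z≤n)

staircase-isCore : ∀ {c} k → k + k ≤ c → IsCore c (staircase k)
staircase-isCore k k+k≤c i j j<part = <⇒≢ (<-≤-trans (hook-staircase-< k i j j<part) k+k≤c)

-- The cell in row 0 and column k-1-m has arm and leg both equal to m.
staircase-¬isCore : ∀ {m k} → m < k → ¬ IsCore (suc (m + m)) (staircase k)
staircase-¬isCore {m} {suc k} (s≤s m≤k) isCore = isCore 0 (k ∸ m) (s≤s (m∸n≤m k m)) hook≡1+2m
  where
    open ≡-Reasoning
    arm≡m : k ∸ (k ∸ m) ≡ m
    arm≡m = m∸[m∸n]≡n m≤k
    leg≡m : conjPart (staircase (suc k)) (k ∸ m) ∸ 1 ≡ m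
    leg≡m = begin
      conjPart (staircase (suc k)) (k ∸ m) ∸ 1  ≡⟨ cong (_∸ 1) (conjPart-staircase (suc k) (k ∸ m)) ⟩
      suc k ∸ (k ∸ m) ∸ 1                       ≡⟨ cong (_∸ 1) (+-∸-assoc 1 (m∸n≤m k m)) ⟩
      k ∸ (k ∸ m)                               ≡⟨ arm≡m ⟩
      m                                         ∎
    hook≡1+2m : hook (staircase (suc k)) 0 (k ∸ m) ≡ suc (m + m)
    hook≡1+2m = begin
      k ∸ (k ∸ m) + (conjPart (staircase (suc k)) (k ∸ m) ∸ 1) + 1  ≡⟨ cong₂ (λ a l → a + l + 1) arm≡m leg≡m ⟩
      m + m + 1                                                     ≡⟨ +-comm (m + m) 1 ⟩
      suc (m + m)                                                   ∎

length-conjugate : ∀ μ → length (conjugate μ) ≡ part μ 0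
length-conjugate μ = trans (length-map (conjPart μ) (upTo (part μ 0))) (length-upTo (part μ 0))

length<head : ∀ x xs → Linked _>_ (x ∷ xs) → All (0 <_) (x ∷ xs) → length xs < x
length<head x []       _            (0<x ∷ []) = 0<x
length<head x (y ∷ ys) (x>y ∷ dis) (_ ∷ pos)  = ≤-trans (s≤s (length<head y ys dis pos)) x>y

distinct-head≡length⇒staircase : ∀ μ → All (0 <_) μ → HasDistinctParts μ →
  part μ 0 ≡ length μ → μ ≡ staircase (length μ)
distinct-head≡length⇒staircase []           _         _           _    = refl
distinct-head≡length⇒staircase (x ∷ [])     _         _           refl = refl
distinct-head≡length⇒staircase (x ∷ y ∷ ys) (_ ∷ pos) (x>y ∷ dis) refl =
  cong (x ∷_) (distinct-head≡length⇒staircase (y ∷ ys) pos dis y≡1+|ys|)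
  where
    y≡1+|ys| : y ≡ suc (length ys)
    y≡1+|ys| = ≤-antisym (≤-pred x>y) (length<head y ys dis pos)

selfConjugate-distinct⇒staircase : ∀ {μ} → IsPartition μ → HasDistinctParts μ →
  SelfConjugate μ → μ ≡ staircase (length μ)
selfConjugate-distinct⇒staircase {μ} (pos , _) dis selfConj =
  distinct-head≡length⇒staircase μ pos dis (trans (sym (length-conjugate μ)) (cong length selfConj))

staircase-injective : ∀ {i j} → staircase i ≡ staircase j → i ≡ j
staircase-injective {i} {j} eq =
  trans (sym (length-staircase i)) (trans (cong length eq) (length-staircase j))

data _≡⌊_/2⌋ : ℕ → ℕ → Set where
  even : ∀ {m} → m ≡⌊ m + m /2⌋
  odd  : ∀ {m} → m ≡⌊ suc (m + m) /2⌋

⌊/2⌋-double≤ : ∀ {m s} → m ≡⌊ s /2⌋ → m + m ≤ s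
⌊/2⌋-double≤ even = ≤-refl
⌊/2⌋-double≤ odd  = n≤1+n _

⌊/2⌋-isCore-odd : ∀ {m s μ} → m ≡⌊ s /2⌋ → IsCore s μ → IsCore (suc s) μ → IsCore (suc (m + m)) μ
⌊/2⌋-isCore-odd even _        isCore-1+s = isCore-1+s
⌊/2⌋-isCore-odd odd  isCore-s _          = isCore-s

staircase⇒Fstar-set : ∀ {s m k} → m ≡⌊ s /2⌋ → k ≤ m → Fstar-set s (staircase k)
staircase⇒Fstar-set {s} {k = k} m≡⌊s/2⌋ k≤m =
  staircase-isPartition k , staircase-hasDistinctParts k , staircase-selfConjugate k ,
  staircase-isCore k 2k≤s , staircase-isCore k (m≤n⇒m≤1+n 2k≤s)
  where
    2k≤s : k + k ≤ s
    2k≤s = ≤-trans (+-mono-≤ k≤m k≤m) (⌊/2⌋-double≤ m≡⌊s/2⌋)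

Fstar-set⇒staircase : ∀ {s m μ} → m ≡⌊ s /2⌋ → Fstar-set s μ → ∃[ k ] k < suc m × μ ≡ staircase k
Fstar-set⇒staircase {m = m} {μ} m≡⌊s/2⌋ (isPartition , distinct , selfConj , isCore-s , isCore-1+s)
  with μ≡staircase ← selfConjugate-distinct⇒staircase isPartition distinct selfConj
  with length μ ≤? m
... | yes |μ|≤m = length μ , s≤s |μ|≤m , μ≡staircase
... | no  |μ|≰m = ⊥-elim (staircase-¬isCore (≰⇒> |μ|≰m) (subst (IsCore (suc (m + m))) μ≡staircase isCore-1+2m))
  where
    isCore-1+2m : IsCore (suc (m + m)) μ
    isCore-1+2m = ⌊/2⌋-isCore-odd {μ = μ} m≡⌊s/2⌋ isCore-s isCore-1+s

Fstar-count : ∀ {s m} → m ≡⌊ s /2⌋ → HasCount (Fstar-set s) (suc m)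
Fstar-count {s} {m} m≡⌊s/2⌋ =
  applyUpTo staircase (suc m) ,
  applyUpTo⁺₁ staircase (suc m) (λ i<j _ → <⇒≢ i<j ∘ staircase-injective) ,
  (λ μ → mk⇔ enumerated⇒Fstar-set Fstar-set⇒enumerated) ,
  length-applyUpTo staircase (suc m)
  where
    enumerated⇒Fstar-set : ∀ {μ} → μ ∈ applyUpTo staircase (suc m) → Fstar-set s μ
    enumerated⇒Fstar-set μ∈ with ∈-applyUpTo⁻ staircase μ∈
    ... | k , s≤s k≤m , refl = staircase⇒Fstar-set m≡⌊s/2⌋ k≤m
    Fstar-set⇒enumerated : ∀ {μ} → Fstar-set s μ → μ ∈ applyUpTo staircase (suc m)
    Fstar-set⇒enumerated Fμ with Fstar-set⇒staircase m≡⌊s/2⌋ Fμ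
    ... | k , k<1+m , refl = ∈-applyUpTo⁺ staircase k<1+m

proposition6p4 : HasCount (Fstar-set 1) 1 × HasCount (Fstar-set 2) 2
    × (∀ (α : ℕ) → α ≥ 1 →
        HasCount (Fstar-set (2 * α)) (α + 1) × HasCount (Fstar-set (2 * α + 1)) (α + 1))
proposition6p4 = Fstar-count (odd {0}) , Fstar-count (even {1}) , λ α _ →
  subst (HasCount _) (+-comm 1 α) (Fstar-count (subst (α ≡⌊_/2⌋) (sym (2α≡α+α α)) even)) ,
  subst (HasCount _) (+-comm 1 α) (Fstar-count (subst (α ≡⌊_/2⌋) (sym (2α+1≡1+α+α α)) odd))
  where
    2α≡α+α : ∀ α → 2 * α ≡ α + α
    2α≡α+α α = cong (α +_) (+-identityʳ α)
    2α+1≡1+α+α : ∀ α → 2 * α + 1 ≡ suc (α + α)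
    2α+1≡1+α+α α = trans (+-comm (2 * α) 1) (cong suc (2α≡α+α α))
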